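{- Let $H$ be a graph and $n\ge 1$. The clique corona $G=H\circ K_n$ is a König–Egerváry graph if and only if $n=1$.
   Context: All graphs are finite, simple and undirected. A graph $G$ is König–Egerváry if $\alpha(G)+\mu(G)=n(G)$, where $\alpha$ is the independence number, $\mu$ the maximum matching size and $n(G)$ the number of vertices. The corona $H\circ X$ is obtained from $H$ by taking, for each vertex $v$ of $H$, a disjoint copy of $X$ and joining $v$ to all vertices of that copy; $K_n$ is the complete graph on $n$ vertices. -}

module Defs where

open import Data.Nat using (ℕ; _+_; _*_; _≤_)
open import Data.Bool using (Bool; true; false; not; _∧_)
open import Data.Fin using (Fin; splitAt; remQuot; _≟_)
open import Data.Fin.Subset using (Subset; _∈_; ∣_∣)
open import Data.Sum using (_⊎_; inj₁; inj₂)
open import Data.Product using (_×_; _,_; Σ; ∃; ∃-syntax; proj₁; proj₂)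
open import Data.List using (List; []; _∷_; length; concatMap)
open import Data.List.Relation.Unary.All using (All)
open import Data.List.Relation.Unary.Unique.Propositional using (Unique)
open import Relation.Binary.PropositionalEquality using (_≡_; refl; sym)
open import Relation.Nullary.Decidable using (⌊_⌋)
open import Relation.Nullary using (yes; no)

record Graph : Set where
  field
    V     : ℕ
    adj   : Fin V → Fin V → Bool
    adj-sym : ∀ i j → adj i j ≡ adj j i
    adj-irrefl : ∀ i → adj i i ≡ false
open Graph public

IsIndependent : (G : Graph) → Subset (V G) → Set
IsIndependent G S = ∀ i j → i ∈ S → j ∈ S → adj G i j ≡ false

IsIndependenceNumber : Graph → ℕ → Set
IsIndependenceNumber G a =
  (∃[ S ] (IsIndependent G S × ∣ S ∣ ≡ a)) ×
  (∀ S → IsIndependent G S → ∣ S ∣ ≤ a)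

endpoints : ∀ {n} → List (Fin n × Fin n) → List (Fin n)
endpoints = concatMap (λ e → proj₁ e ∷ proj₂ e ∷ [])

IsMatching : (G : Graph) → List (Fin (V G) × Fin (V G)) → Set
IsMatching G M = All (λ e → adj G (proj₁ e) (proj₂ e) ≡ true) M × Unique (endpoints M)

IsMatchingNumber : Graph → ℕ → Set
IsMatchingNumber G m =
  (∃[ M ] (IsMatching G M × length M ≡ m)) ×
  (∀ M → IsMatching G M → length M ≤ m)

KönigEgervary : Graph → Set
KönigEgervary G = ∃[ a ] ∃[ m ] (IsIndependenceNumber G a × IsMatchingNumber G m × a + m ≡ V G)

K : ℕ → Graph
K n = record
  { V = n
  ; adj = λ i j → not ⌊ i ≟ j ⌋
  ; adj-sym = symK
  ; adj-irrefl = irreflK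
  }
  where
  symK : ∀ i j → not ⌊ i ≟ j ⌋ ≡ not ⌊ j ≟ i ⌋
  symK i j with i ≟ j | j ≟ i
  ... | yes _ | yes _ = refl
  ... | no _  | no _  = refl
  ... | yes p | no q  with q (sym p)
  ... | ()
  symK i j | no q | yes p with q (sym p)
  ... | ()
  irreflK : ∀ i → not ⌊ i ≟ i ⌋ ≡ false
  irreflK i with i ≟ i
  ... | yes _ = refl
  ... | no q with q refl
  ... | ()

-- Vertex set Fin (V H + V H * V X): the first V H vertices are
-- those of H; a vertex of the remaining block decodes (via remQuot) to a pair
-- (v , x), meaning vertex x of the copy of X attached to vertex v of H.
CVert : Graph → Graph → Set
CVert H X = Fin (V H) ⊎ (Fin (V H) × Fin (V X))

decode : (H X : Graph) → Fin (V H + V H * V X) → CVert H X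
decode H X i with splitAt (V H) i
... | inj₁ u = inj₁ u
... | inj₂ p = inj₂ (remQuot {V H} (V X) p)

cadj : (H X : Graph) → CVert H X → CVert H X → Bool
cadj H X (inj₁ u) (inj₁ w) = adj H u w
cadj H X (inj₁ u) (inj₂ (v , _)) = ⌊ u ≟ v ⌋
cadj H X (inj₂ (v , _)) (inj₁ w) = ⌊ v ≟ w ⌋
cadj H X (inj₂ (v , x)) (inj₂ (v' , x')) = ⌊ v ≟ v' ⌋ ∧ adj X x x'

private
  ≟-sym : ∀ {k} (a b : Fin k) → ⌊ a ≟ b ⌋ ≡ ⌊ b ≟ a ⌋
  ≟-sym a b with a ≟ b | b ≟ a
  ... | yes _ | yes _ = refl
  ... | no _  | no _  = refl
  ... | yes e | no f with f (sym e)
  ... | ()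
  ≟-sym a b | no f | yes e with f (sym e)
  ... | ()

cadj-sym : (H X : Graph) → ∀ a b → cadj H X a b ≡ cadj H X b a
cadj-sym H X (inj₁ u) (inj₁ w) = adj-sym H u w
cadj-sym H X (inj₁ u) (inj₂ (v , _)) = ≟-sym u v
cadj-sym H X (inj₂ (v , _)) (inj₁ w) = ≟-sym v w
cadj-sym H X (inj₂ (v , x)) (inj₂ (v' , x'))
  rewrite ≟-sym v v' | adj-sym X x x' = refl

cadj-irrefl : (H X : Graph) → ∀ a → cadj H X a a ≡ false
cadj-irrefl H X (inj₁ u) = adj-irrefl H u
cadj-irrefl H X (inj₂ (v , x)) with v ≟ v
... | yes _ = adj-irrefl X x
... | no _ = refl

_∘ᶜ_ : Graph → Graph → Graph
H ∘ᶜ X = record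
  { V = V H + V H * V X
  ; adj = λ i j → cadj H X (decode H X i) (decode H X j)
  ; adj-sym = λ i j → cadj-sym H X (decode H X i) (decode H X j)
  ; adj-irrefl = λ i → cadj-irrefl H X (decode H X i)
  }

{-# OPTIONS --safe #-}
module Submission where

-- In H ∘ K n each root together with its copy of K n is a clique, and these V H
-- cliques partition the vertices.  An independent set meets each of them at most
-- once, so α ≤ V H, while 2μ ≤ N = V H (n + 1).  König–Egerváry then forces
-- μ = N − α ≥ n V H, hence N ≤ 2 V H, i.e. n ≤ 1.  Conversely, in H ∘ K 1 the
-- pendant vertices form an independent set of size V H, and the spokes joining
-- each root to its pendant vertex form a perfect matching.

open import Defs
open import Data.Nat using (ℕ; zero; suc; _+_; _*_; _≤_; _≥_; _>_; s≤s⁻¹; >-nonZero)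
open import Data.Nat.Properties
  using (≤-trans; ≤-antisym; ≤-reflexive; +-cancelˡ-≤; +-monoˡ-≤; +-monoʳ-≤; +-comm; +-identityʳ;
         *-comm; *-distribˡ-+; *-monoʳ-≤; *-cancelˡ-≤; *-suc; *-identityʳ; module ≤-Reasoning)
open import Data.Bool using (true; false; _∧_)
open import Data.Bool.Properties using (∧-zeroʳ)
open import Data.Fin using (Fin; zero; suc; splitAt; remQuot; combine; _↑ˡ_; _↑ʳ_; _≟_)
open import Data.Fin.Properties
  using (injective⇒≤; suc-injective; splitAt-↑ˡ; splitAt-↑ʳ; splitAt⁻¹-↑ˡ; splitAt⁻¹-↑ʳ;
         remQuot-combine; combine-remQuot)
open import Data.Fin.Subset using (Subset; _∈_; ∣_∣; inside; outside; ⊥; ⊤)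
open import Data.Fin.Subset.Properties using (∣⊤∣≡n)
open import Data.Vec using (_∷_; _++_; here; there)
open import Data.Sum using (inj₁; inj₂)
open import Data.Sum.Properties using (inj₁-injective; inj₂-injective)
open import Data.Product using (_×_; _,_; ∃-syntax; proj₁)
open import Data.List using (List; []; _∷_; length; lookup; map; allFin)
open import Data.List.Properties using (length-map; length-tabulate)
open import Data.List.Membership.Propositional.Properties using (∈-lookup)
open import Data.List.Relation.Unary.All as All using (All; []; _∷_; universal)
import Data.List.Relation.Unary.All.Properties as All
open import Data.List.Relation.Unary.AllPairs using ([]; _∷_)
open import Data.List.Relation.Unary.Unique.Propositional using (Unique)
open import Data.List.Relation.Unary.Unique.Propositional.Properties using (allFin⁺)
open import Function using (_∘_; Injective)
open import Function.Bundles using (_⇔_; mk⇔)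
open import Relation.Binary.PropositionalEquality using (_≡_; _≢_; refl; sym; trans; cong; cong₂)
open import Relation.Nullary using (yes; no; contradiction)
open import Relation.Nullary.Decidable using (⌊_⌋; isYes≗does; dec-true)

Unique⇒lookup-injective : ∀ {A : Set} {xs : List A} → Unique xs →
                          ∀ i j → lookup xs i ≡ lookup xs j → i ≡ j
Unique⇒lookup-injective (_    ∷ _) zero    zero    _  = refl
Unique⇒lookup-injective (x∉xs ∷ _) zero    (suc j) eq = contradiction eq (All.lookup x∉xs (∈-lookup j))
Unique⇒lookup-injective (x∉xs ∷ _) (suc i) zero    eq = contradiction (sym eq) (All.lookup x∉xs (∈-lookup i))
Unique⇒lookup-injective (_    ∷ u) (suc i) (suc j) eq = cong suc (Unique⇒lookup-injective u i j eq)

Unique⇒length≤ : ∀ {k} {xs : List (Fin k)} → Unique xs → length xs ≤ k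
Unique⇒length≤ u = injective⇒≤ (Unique⇒lookup-injective u _ _)

enumerate : ∀ {k} (p : Subset k) → Fin ∣ p ∣ → Fin k
enumerate (inside  ∷ p) zero    = zero
enumerate (inside  ∷ p) (suc i) = suc (enumerate p i)
enumerate (outside ∷ p) i       = suc (enumerate p i)

enumerate-∈ : ∀ {k} (p : Subset k) i → enumerate p i ∈ p
enumerate-∈ (inside  ∷ p) zero    = here
enumerate-∈ (inside  ∷ p) (suc i) = there (enumerate-∈ p i)
enumerate-∈ (outside ∷ p) i       = there (enumerate-∈ p i)

enumerate-injective : ∀ {k} (p : Subset k) → Injective _≡_ _≡_ (enumerate p)
enumerate-injective (inside  ∷ p) {zero}  {zero}  _  = refl
enumerate-injective (inside  ∷ p) {suc i} {suc j} eq = cong suc (enumerate-injective p (suc-injective eq))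
enumerate-injective (outside ∷ p) eq = enumerate-injective p (suc-injective eq)

injectiveOn⇒∣p∣≤ : ∀ {k m} (p : Subset k) (f : Fin k → Fin m) →
                   (∀ {i j} → i ∈ p → j ∈ p → f i ≡ f j → i ≡ j) → ∣ p ∣ ≤ m
injectiveOn⇒∣p∣≤ p f f-inj = injective⇒≤ {f = f ∘ enumerate p}
  λ {i} {j} eq → enumerate-injective p (f-inj (enumerate-∈ p i) (enumerate-∈ p j) eq)

∣⊥++p∣≡∣p∣ : ∀ m {n} (p : Subset n) → ∣ ⊥ {m} ++ p ∣ ≡ ∣ p ∣
∣⊥++p∣≡∣p∣ zero    p = refl
∣⊥++p∣≡∣p∣ (suc m) p = ∣⊥++p∣≡∣p∣ m p

∈⊥++p⇒↑ʳ : ∀ m {n} {p : Subset n} {i} → i ∈ ⊥ {m} ++ p → ∃[ j ] m ↑ʳ j ≡ i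
∈⊥++p⇒↑ʳ zero    {i = i} _ = i , refl
∈⊥++p⇒↑ʳ (suc m) (there i∈) = let j , eq = ∈⊥++p⇒↑ʳ m i∈ in j , cong suc eq

length-endpoints : ∀ {k} (M : List (Fin k × Fin k)) → length (endpoints M) ≡ 2 * length M
length-endpoints []      = refl
length-endpoints (_ ∷ M) = trans (cong (2 +_) (length-endpoints M)) (sym (*-suc 2 (length M)))

IsMatching⇒2*length≤V : ∀ G {M} → IsMatching G M → 2 * length M ≤ V G
IsMatching⇒2*length≤V G {M} (_ , u) = ≤-trans (≤-reflexive (sym (length-endpoints M))) (Unique⇒length≤ u)

Unique-endpoints-map : ∀ {A : Set} {k} {f g : A → Fin k} →
                       Injective _≡_ _≡_ f → Injective _≡_ _≡_ g → (∀ x y → f x ≢ g y) →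
                       ∀ {xs} → Unique xs → Unique (endpoints (map (λ x → f x , g x) xs))
Unique-endpoints-map {f = f} {g} f-inj g-inj f≢g = go
  where
  All-endpoints : ∀ {P : Fin _ → Set} {ys} → All (λ y → P (f y) × P (g y)) ys →
                  All P (endpoints (map (λ x → f x , g x) ys))
  All-endpoints []               = []
  All-endpoints ((pf , pg) ∷ ps) = pf ∷ pg ∷ All-endpoints ps

  go : ∀ {xs} → Unique xs → Unique (endpoints (map (λ x → f x , g x) xs))
  go []              = []
  go {x ∷ _} (x∉ ∷ u) =
    (f≢g x x ∷ All-endpoints (All.map (λ x≢y → x≢y ∘ f-inj , f≢g x _) x∉)) ∷
    All-endpoints (All.map (λ x≢y → f≢g _ x ∘ sym , x≢y ∘ g-inj) x∉) ∷
    go u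

module _ (H X : Graph) where

  encode : CVert H X → Fin (V (H ∘ᶜ X))
  encode (inj₁ u)       = u ↑ˡ (V H * V X)
  encode (inj₂ (v , x)) = V H ↑ʳ combine v x

  decode-↑ˡ : ∀ u → decode H X (u ↑ˡ (V H * V X)) ≡ inj₁ u
  decode-↑ˡ u rewrite splitAt-↑ˡ (V H) u (V H * V X) = refl

  decode-↑ʳ : ∀ p → decode H X (V H ↑ʳ p) ≡ inj₂ (remQuot (V X) p)
  decode-↑ʳ p rewrite splitAt-↑ʳ (V H) (V H * V X) p = refl

  decode-encode : ∀ a → decode H X (encode a) ≡ a
  decode-encode (inj₁ u)       = decode-↑ˡ u
  decode-encode (inj₂ (v , x)) = trans (decode-↑ʳ (combine v x)) (cong inj₂ (remQuot-combine v x))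

  encode-decode : ∀ i → encode (decode H X i) ≡ i
  encode-decode i with splitAt (V H) i in eq
  ... | inj₁ u = splitAt⁻¹-↑ˡ eq
  ... | inj₂ p = trans (cong (V H ↑ʳ_) (combine-remQuot {V H} (V X) p)) (splitAt⁻¹-↑ʳ eq)

  encode-injective : Injective _≡_ _≡_ encode
  encode-injective {a} {b} eq = trans (sym (decode-encode a)) (trans (cong (decode H X) eq) (decode-encode b))

  decode-injective : Injective _≡_ _≡_ (decode H X)
  decode-injective {i} {j} eq = trans (sym (encode-decode i)) (trans (cong encode eq) (encode-decode j))

  adj-encode : ∀ a b → adj (H ∘ᶜ X) (encode a) (encode b) ≡ cadj H X a b
  adj-encode a b = cong₂ (cadj H X) (decode-encode a) (decode-encode b)

  root : CVert H X → Fin (V H)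
  root (inj₁ u)       = u
  root (inj₂ (v , _)) = v

isYes-≟-refl : ∀ {k} (i : Fin k) → ⌊ i ≟ i ⌋ ≡ true
isYes-≟-refl i = trans (isYes≗does (i ≟ i)) (dec-true (i ≟ i) refl)

sameRoot-nonadjacent⇒≡ : ∀ H n (a b : CVert H (K n)) →
                         root H (K n) a ≡ root H (K n) b → cadj H (K n) a b ≡ false → a ≡ b
sameRoot-nonadjacent⇒≡ H n (inj₁ u) (inj₁ .u) refl _ = refl
sameRoot-nonadjacent⇒≡ H n (inj₁ u) (inj₂ (.u , _)) refl e = contradiction (trans (sym (isYes-≟-refl u)) e) λ ()
sameRoot-nonadjacent⇒≡ H n (inj₂ (v , _)) (inj₁ .v) refl e = contradiction (trans (sym (isYes-≟-refl v)) e) λ ()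
sameRoot-nonadjacent⇒≡ H n (inj₂ (v , x)) (inj₂ (.v , y)) refl e
  rewrite isYes-≟-refl v with x ≟ y
... | yes refl = refl
... | no _     = contradiction e λ ()

cliqueCorona-independent⇒∣S∣≤ : ∀ H n {S} → IsIndependent (H ∘ᶜ K n) S → ∣ S ∣ ≤ V H
cliqueCorona-independent⇒∣S∣≤ H n {S} S-ind = injectiveOn⇒∣p∣≤ S (root H (K n) ∘ decode H (K n))
  λ {i} {j} i∈S j∈S eq → decode-injective H (K n)
    (sameRoot-nonadjacent⇒≡ H n (decode H (K n) i) (decode H (K n) j) eq (S-ind i j i∈S j∈S))

a≤h⇒2*m≤N⇒a+m≡N⇒N≤2*h : ∀ {a h m N} → a ≤ h → 2 * m ≤ N → a + m ≡ N → N ≤ 2 * h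
a≤h⇒2*m≤N⇒a+m≡N⇒N≤2*h {a} {h} {m} {N} a≤h 2m≤N a+m≡N = +-cancelˡ-≤ N N (2 * h) (begin
  N + N             ≡⟨ cong (N +_) (sym (+-identityʳ N)) ⟩
  2 * N             ≤⟨ *-monoʳ-≤ 2 N≤h+m ⟩
  2 * (h + m)       ≡⟨ *-distribˡ-+ 2 h m ⟩
  2 * h + 2 * m     ≤⟨ +-monoʳ-≤ (2 * h) 2m≤N ⟩
  2 * h + N         ≡⟨ +-comm (2 * h) N ⟩
  N + 2 * h         ∎)
  where
  open ≤-Reasoning
  N≤h+m : N ≤ h + m
  N≤h+m = ≤-trans (≤-reflexive (sym a+m≡N)) (+-monoˡ-≤ m a≤h)

cliqueCorona-KönigEgervary⇒n≤1 : ∀ H n → V H > 0 → KönigEgervary (H ∘ᶜ K n) → n ≤ 1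
cliqueCorona-KönigEgervary⇒n≤1 H n h>0 (_ , _ , ((S , S-ind , refl) , _) , ((M , M-match , refl) , _) , α+μ≡N) =
  s≤s⁻¹ (*-cancelˡ-≤ (V H) {{>-nonZero h>0}} (begin
    V H * suc n     ≡⟨ *-suc (V H) n ⟩
    V H + V H * n   ≤⟨ N≤2h ⟩
    2 * V H         ≡⟨ *-comm 2 (V H) ⟩
    V H * 2         ∎))
  where
  open ≤-Reasoning
  N≤2h : V (H ∘ᶜ K n) ≤ 2 * V H
  N≤2h = a≤h⇒2*m≤N⇒a+m≡N⇒N≤2*h (cliqueCorona-independent⇒∣S∣≤ H n S-ind)
                               (IsMatching⇒2*length≤V (H ∘ᶜ K n) M-match) α+μ≡N

copyVertices : (H X : Graph) → Subset (V (H ∘ᶜ X))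
copyVertices H X = ⊥ {V H} ++ ⊤ {V H * V X}

∣copyVertices∣ : ∀ H X → ∣ copyVertices H X ∣ ≡ V H * V X
∣copyVertices∣ H X = trans (∣⊥++p∣≡∣p∣ (V H) ⊤) (∣⊤∣≡n (V H * V X))

copyVertices-independent : ∀ H X → (∀ x y → adj X x y ≡ false) → IsIndependent (H ∘ᶜ X) (copyVertices H X)
copyVertices-independent H X edgeless i j i∈ j∈
  with ∈⊥++p⇒↑ʳ (V H) i∈ | ∈⊥++p⇒↑ʳ (V H) j∈
... | p , refl | q , refl rewrite decode-↑ʳ H X p | decode-↑ʳ H X q =
  trans (cong (_ ∧_) (edgeless _ _)) (∧-zeroʳ _)

spokes : (H X : Graph) → Fin (V X) → List (Fin (V (H ∘ᶜ X)) × Fin (V (H ∘ᶜ X)))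
spokes H X x = map (λ v → encode H X (inj₁ v) , encode H X (inj₂ (v , x))) (allFin (V H))

length-spokes : ∀ H X x → length (spokes H X x) ≡ V H
length-spokes H X x = trans (length-map _ (allFin (V H))) (length-tabulate (λ v → v))

spokes-isMatching : ∀ H X x → IsMatching (H ∘ᶜ X) (spokes H X x)
spokes-isMatching H X x =
  All.map⁺ (universal (λ v → trans (adj-encode H X (inj₁ v) (inj₂ (v , x))) (isYes-≟-refl v)) (allFin (V H))) ,
  Unique-endpoints-map (inj₁-injective ∘ encode-injective H X)
                       (cong proj₁ ∘ inj₂-injective ∘ encode-injective H X)
                       (λ v w → (λ ()) ∘ encode-injective H X {inj₁ v} {inj₂ (w , x)})
                       (allFin⁺ (V H))

K1-edgeless : ∀ x y → adj (K 1) x y ≡ false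
K1-edgeless zero zero = refl

corona-K1-KönigEgervary : ∀ H → KönigEgervary (H ∘ᶜ K 1)
corona-K1-KönigEgervary H =
  V H , V H ,
  ((copyVertices H (K 1) , copyVertices-independent H (K 1) K1-edgeless , trans (∣copyVertices∣ H (K 1)) h*1≡h) ,
   λ _ → cliqueCorona-independent⇒∣S∣≤ H 1) ,
  ((spokes H (K 1) zero , spokes-isMatching H (K 1) zero , length-spokes H (K 1) zero) , matching≤h) ,
  cong (V H +_) (sym h*1≡h)
  where
  h*1≡h : V H * 1 ≡ V H
  h*1≡h = *-identityʳ (V H)

  matching≤h : ∀ M → IsMatching (H ∘ᶜ K 1) M → length M ≤ V H
  matching≤h _ M-match = *-cancelˡ-≤ 2 (≤-trans (IsMatching⇒2*length≤V (H ∘ᶜ K 1) M-match)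
    (≤-reflexive (cong (V H +_) (trans h*1≡h (sym (+-identityʳ (V H)))))))

corollary2p4 : (H : Graph) → V H > 0 → (n : ℕ) → n ≥ 1 →
    KönigEgervary (H ∘ᶜ K n) ⇔ n ≡ 1
corollary2p4 H h>0 n n≥1 = mk⇔
  (λ ke → ≤-antisym (cliqueCorona-KönigEgervary⇒n≤1 H n h>0 ke) n≥1)
  (λ { refl → corona-K1-KönigEgervary H })
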